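{- Let $d\ge 4$ be a fixed even integer. For every fixed $\lambda$ with $0<\lambda<1$ there exists an integer $n_0(\lambda)$ such that for every $n>n_0(\lambda)$, every optimal binary $(n,M,\{d,d+2\})$-code satisfies \[M\ \ge\ \frac{\lambda n^2}{(\frac{d}{2}+1)\frac{d}{2}}.\]
   Context: A binary code of length $n$ is a subset $C\subseteq\{0,1\}^n$; $d(\cdot,\cdot)$ is the Hamming distance. $C$ is an $(n,M,\{d_1,d_2\})$-code if $|C|=M$ and $\{d(u,v): u,v\in C,\ u\neq v\}=\{d_1,d_2\}$. $A_2(n,\{d_1,d_2\})$ is the maximum size of such a code, and a code is optimal if its size equals $A_2(n,\{d_1,d_2\})$.
   Formalization: The parameter λ ranges only over rational numbers strictly between 0 and 1. -}

module Defs where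

open import Data.Nat using (ℕ; zero; suc; _+_; _≤_)
open import Data.Bool using (Bool; true; false)
open import Data.Vec using (Vec; []; _∷_)
open import Data.List using (List; length)
open import Data.List.Membership.Propositional using (_∈_)
open import Data.List.Relation.Unary.Unique.Propositional using (Unique)
open import Data.Product using (_×_; ∃-syntax)
open import Data.Sum using (_⊎_)
open import Relation.Binary.PropositionalEquality using (_≡_; _≢_)

Word : ℕ → Set
Word n = Vec Bool n

bitDiff : Bool → Bool → ℕ
bitDiff false false = 0
bitDiff true  true  = 0
bitDiff false true  = 1
bitDiff true  false = 1

hd : ∀ {n} → Word n → Word n → ℕ
hd [] [] = 0
hd (x ∷ xs) (y ∷ ys) = bitDiff x y + hd xs ys

-- A code is a duplicate-free list of words; its size M is its length.
-- C is an (n, |C|, {d1,d2})-code iff the set of distances between distinct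
-- codewords is exactly {d1,d2}.
IsTwoDistCode : (n d₁ d₂ : ℕ) → List (Word n) → Set
IsTwoDistCode n d₁ d₂ C =
  Unique C
  × (∀ u v → u ∈ C → v ∈ C → u ≢ v → hd u v ≡ d₁ ⊎ hd u v ≡ d₂)
  × (∃[ u ] ∃[ v ] (u ∈ C × v ∈ C × u ≢ v × hd u v ≡ d₁))
  × (∃[ u ] ∃[ v ] (u ∈ C × v ∈ C × u ≢ v × hd u v ≡ d₂))

IsOptimal : (n d₁ d₂ : ℕ) → List (Word n) → Set
IsOptimal n d₁ d₂ C =
  IsTwoDistCode n d₁ d₂ C
  × (∀ (C' : List (Word n)) → IsTwoDistCode n d₁ d₂ C' → length C' ≤ length C)

module Submission where

-- Write d = 2k and K = k + 1.  All codes built here have constant weight K and distances 2k and 2K.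
-- Let m be coprime to 1, …, k and let C be such a code of length m.  Cut words of length K·m into
-- K blocks of length m, and take
--   • for every a, b < m, the word whose block j is the unit vector at (a + b·j) mod m, and
--   • for every block and every word of C, that word in this block and zeros elsewhere.
-- The first m² words are lines of (ℤ/m)²; two of them meet in at most one of the K columns because
-- differences of column indices are units mod m, so their distance is 2k or 2K.  Hence
-- A(K·m) ≥ m² + K·A(m).  Choosing m ≡ 1 (mod k!) with K·m ≤ n ≤ K·m + O(1) and padding with
-- zeros, t rounds of this recursion give k·K·A(n) ≥ (1 − K⁻ᵗ)·n² − O(n); take K^t > q.

open import Defs
open import Data.Bool using (true; false)
open import Data.Nat
  using (ℕ; zero; suc; _+_; _*_; _∸_; _^_; _≤_; _<_; _≤?_; s≤s; z≤n; NonZero; >-nonZero; >-nonZero⁻¹; _!)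
open import Data.Nat.Properties
open import Data.Nat.DivMod
  using (_%_; _/_; m≡m%n+[m/n]*n; [m+kn]%n≡m%n; m<n⇒m%n≡m; m%n<n; m/n*n≤m; m≥n⇒m/n>0; m*n/n≡m)
open import Data.Nat.Divisibility
  using (_∣_; divides; ∣-trans; m∣m*n; n∣m*n; ∣m+n∣m⇒∣n; ∣1⇒≡1; n∣m⇒m%n≡0; m%n≡0⇒n∣m; m≤n⇒m!∣n!)
open import Data.Nat.Coprimality using (Coprime; coprime-divisor)
open import Data.Nat.Tactic.RingSolver using (solve-∀)
open import Data.List using (List; []; _∷_; length; map; _++_; upTo; cartesianProduct)
open import Data.List.Properties using (length-map; length-++; length-upTo)
open import Data.List.Membership.Propositional using (_∈_)
open import Data.List.Membership.Propositional.Properties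
  using (∈-map⁺; ∈-map⁻; ∈-++⁻; ∈-++⁺ˡ; ∈-cartesianProduct⁺; ∈-cartesianProduct⁻; ∈-upTo⁺; ∈-upTo⁻)
open import Data.List.Relation.Unary.All as All using (All; []; _∷_)
import Data.List.Relation.Unary.All.Properties as All
open import Data.List.Relation.Unary.Any using (here; there)
open import Data.List.Relation.Unary.AllPairs as AllPairs using (AllPairs; []; _∷_)
import Data.List.Relation.Unary.AllPairs.Properties as AllPairs
open import Data.List.Relation.Unary.Unique.Propositional using (Unique)
import Data.List.Relation.Unary.Unique.Propositional.Properties as Unique
open import Data.Product using (_×_; _,_; proj₁; proj₂; Σ-syntax; ∃-syntax)
open import Data.Sum as Sum using (_⊎_; inj₁; inj₂)
open import Data.Vec as Vec using ([]; _∷_; replicate; padRight)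
open import Data.Vec.Properties using (padRight-replicate)
open import Function using (case_of_)
open import Relation.Binary.Core using (Rel)
open import Relation.Binary.Definitions using (Symmetric; tri<; tri≈; tri>)
open import Relation.Nullary using (¬_; yes; no; contradiction)
open import Relation.Binary.PropositionalEquality

sumBelow : ℕ → (ℕ → ℕ) → ℕ
sumBelow zero    h = 0
sumBelow (suc c) h = h c + sumBelow c h

sumBelow-cong : ∀ c {h h′ : ℕ → ℕ} → (∀ j → j < c → h j ≡ h′ j) → sumBelow c h ≡ sumBelow c h′
sumBelow-cong zero    eq = refl
sumBelow-cong (suc c) eq = cong₂ _+_ (eq c ≤-refl) (sumBelow-cong c (λ j j<c → eq j (m<n⇒m<1+n j<c)))

sumBelow-+ : ∀ c (f g : ℕ → ℕ) → sumBelow c (λ j → f j + g j) ≡ sumBelow c f + sumBelow c g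
sumBelow-+ zero    f g = refl
sumBelow-+ (suc c) f g = begin
  f c + g c + sumBelow c (λ j → f j + g j)  ≡⟨ cong (f c + g c +_) (sumBelow-+ c f g) ⟩
  f c + g c + (sumBelow c f + sumBelow c g) ≡⟨ exchange (f c) (g c) (sumBelow c f) (sumBelow c g) ⟩
  f c + sumBelow c f + (g c + sumBelow c g) ∎
  where
  open ≡-Reasoning
  exchange : ∀ a b x y → a + b + (x + y) ≡ a + x + (b + y)
  exchange = solve-∀

sumBelow-const : ∀ c {h : ℕ → ℕ} v → (∀ j → j < c → h j ≡ v) → sumBelow c h ≡ c * v
sumBelow-const zero    v eq = refl
sumBelow-const (suc c) v eq = cong₂ _+_ (eq c ≤-refl) (sumBelow-const c v (λ j j<c → eq j (m<n⇒m<1+n j<c)))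

sumBelow-constExcept : ∀ c {h : ℕ → ℕ} v {i} → i < c → (∀ j → j < c → j ≢ i → h j ≡ v) →
                       sumBelow c h + v ≡ c * v + h i
sumBelow-constExcept (suc c) {h} v {i} i<1+c eq with i ≟ c
... | yes refl = begin
  h c + sumBelow c h + v ≡⟨ cong (λ s → h c + s + v) (sumBelow-const c v below) ⟩
  h c + c * v + v        ≡⟨ rotate (h c) (c * v) v ⟩
  v + c * v + h c        ∎
  where
  open ≡-Reasoning
  below : ∀ j → j < c → h j ≡ v
  below j j<c = eq j (m<n⇒m<1+n j<c) (<⇒≢ j<c)
  rotate : ∀ a b x → a + b + x ≡ x + b + a
  rotate = solve-∀
... | no i≢c = begin
  h c + sumBelow c h + v   ≡⟨ +-assoc (h c) _ v ⟩
  h c + (sumBelow c h + v) ≡⟨ cong₂ _+_ (eq c ≤-refl (≢-sym i≢c)) (sumBelow-constExcept c v i<c below) ⟩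
  v + (c * v + h i)        ≡⟨ +-assoc v (c * v) (h i) ⟨
  v + c * v + h i          ∎
  where
  open ≡-Reasoning
  i<c : i < c
  i<c = ≤∧≢⇒< (≤-pred i<1+c) i≢c
  below : ∀ j → j < c → j ≢ i → h j ≡ v
  below j j<c = eq j (m<n⇒m<1+n j<c)

sumBelow-single : ∀ c {h : ℕ → ℕ} {i} → i < c → (∀ j → j < c → j ≢ i → h j ≡ 0) → sumBelow c h ≡ h i
sumBelow-single c {h} {i} i<c eq = begin
  sumBelow c h     ≡⟨ +-identityʳ _ ⟨
  sumBelow c h + 0 ≡⟨ sumBelow-constExcept c 0 i<c eq ⟩
  c * 0 + h i      ≡⟨ cong (_+ h i) (*-zeroʳ c) ⟩
  h i              ∎
  where open ≡-Reasoning

zeros : ∀ n → Word n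
zeros n = replicate n false

weight : ∀ {n} → Word n → ℕ
weight {n} w = hd w (zeros n)

bitDiff-self : ∀ b → bitDiff b b ≡ 0
bitDiff-self false = refl
bitDiff-self true  = refl

bitDiff-comm : ∀ a b → bitDiff a b ≡ bitDiff b a
bitDiff-comm false false = refl
bitDiff-comm false true  = refl
bitDiff-comm true  false = refl
bitDiff-comm true  true  = refl

hd-self : ∀ {n} (u : Word n) → hd u u ≡ 0
hd-self []      = refl
hd-self (x ∷ u) = cong₂ _+_ (bitDiff-self x) (hd-self u)

hd-comm : ∀ {n} (u v : Word n) → hd u v ≡ hd v u
hd-comm []      []      = refl
hd-comm (x ∷ u) (y ∷ v) = cong₂ _+_ (bitDiff-comm x y) (hd-comm u v)

hd-zeros-either : ∀ {n} {u v : Word n} → u ≡ zeros n ⊎ v ≡ zeros n → hd u v ≡ weight u + weight v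
hd-zeros-either {n} {v = v} (inj₁ refl) = trans (hd-comm (zeros n) v) (cong (_+ weight v) (sym (hd-self (zeros n))))
hd-zeros-either {n} {u = u} (inj₂ refl) = sym (trans (cong (weight u +_) (hd-self (zeros n))) (+-identityʳ _))

hd-++ : ∀ {a b} (u v : Word a) (u′ v′ : Word b) → hd (u Vec.++ u′) (v Vec.++ v′) ≡ hd u v + hd u′ v′
hd-++ []      []      u′ v′ = refl
hd-++ (x ∷ u) (y ∷ v) u′ v′ = trans (cong (bitDiff x y +_) (hd-++ u v u′ v′)) (sym (+-assoc (bitDiff x y) _ _))

hd-padRight : ∀ {a n} (a≤n : a ≤ n) (u v : Word a) →
              hd (padRight a≤n false u) (padRight a≤n false v) ≡ hd u v
hd-padRight {n = n} z≤n []      []      = hd-self (zeros n)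
hd-padRight (s≤s a≤n)   (x ∷ u) (y ∷ v) = cong (bitDiff x y +_) (hd-padRight a≤n u v)

weight-padRight : ∀ {a n} (a≤n : a ≤ n) (u : Word a) → weight (padRight a≤n false u) ≡ weight u
weight-padRight {a} a≤n u =
  trans (cong (hd (padRight a≤n false u)) (padRight-replicate a≤n false)) (hd-padRight a≤n u (zeros a))

unit : (m x : ℕ) → Word m
unit zero    x       = []
unit (suc m) zero    = true ∷ zeros m
unit (suc m) (suc x) = false ∷ unit m x

weight-unit : ∀ {m x} → x < m → weight (unit m x) ≡ 1
weight-unit {suc m} {zero}  _         = cong suc (hd-self (zeros m))
weight-unit {suc m} {suc x} (s≤s x<m) = weight-unit x<m

hd-unit-unit : ∀ {m x y} → x < m → y < m → x ≢ y → hd (unit m x) (unit m y) ≡ 2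
hd-unit-unit {suc m} {zero}  {zero}  _         _         x≢y = contradiction refl x≢y
hd-unit-unit {suc m} {zero}  {suc y} _         (s≤s y<m) _   =
  cong suc (trans (hd-comm (zeros m) (unit m y)) (weight-unit y<m))
hd-unit-unit {suc m} {suc x} {zero}  (s≤s x<m) _         _   = cong suc (weight-unit x<m)
hd-unit-unit {suc m} {suc x} {suc y} (s≤s x<m) (s≤s y<m) x≢y =
  hd-unit-unit x<m y<m (λ x≡y → x≢y (cong suc x≡y))

hd-unit : ∀ {m x} (w : Word m) → x < m → suc (hd w (unit m x)) ≡ weight w ⊎ hd w (unit m x) ≡ suc (weight w)
hd-unit {suc m} {zero}  (true  ∷ w) _         = inj₁ refl
hd-unit {suc m} {zero}  (false ∷ w) _         = inj₂ refl
hd-unit {suc m} {suc x} (b ∷ w)     (s≤s x<m) with hd-unit w x<m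
... | inj₁ eq = inj₁ (trans (sym (+-suc (bitDiff b false) _)) (cong (bitDiff b false +_) eq))
... | inj₂ eq = inj₂ (trans (cong (bitDiff b false +_) eq) (+-suc (bitDiff b false) _))

concatBlocks : ∀ {m} c → (ℕ → Word m) → Word (c * m)
concatBlocks zero    f = []
concatBlocks (suc c) f = f c Vec.++ concatBlocks c f

hd-concatBlocks : ∀ {m} c (f g : ℕ → Word m) →
                  hd (concatBlocks c f) (concatBlocks c g) ≡ sumBelow c (λ j → hd (f j) (g j))
hd-concatBlocks zero    f g = refl
hd-concatBlocks (suc c) f g =
  trans (hd-++ (f c) (g c) _ _) (cong (hd (f c) (g c) +_) (hd-concatBlocks c f g))

concatBlocks-zeros : ∀ {m} c → concatBlocks c (λ _ → zeros m) ≡ zeros (c * m)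
concatBlocks-zeros {m} zero    = refl
concatBlocks-zeros {m} (suc c) = trans (cong (zeros m Vec.++_) (concatBlocks-zeros c)) (zeros-++ m)
  where
  zeros-++ : ∀ a {b} → zeros a Vec.++ zeros b ≡ zeros (a + b)
  zeros-++ zero    = refl
  zeros-++ (suc a) = cong (false ∷_) (zeros-++ a)

weight-concatBlocks : ∀ {m} c (f : ℕ → Word m) →
                      weight (concatBlocks c f) ≡ sumBelow c (λ j → weight (f j))
weight-concatBlocks c f =
  trans (cong (hd (concatBlocks c f)) (sym (concatBlocks-zeros c))) (hd-concatBlocks c f (λ _ → zeros _))

module _ {A : Set} {ℓ} {S : Rel A ℓ} where

  Unique⇒AllPairs : ∀ {xs} → Unique xs → (∀ {x y} → x ∈ xs → y ∈ xs → x ≢ y → S x y) → AllPairs S xs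
  Unique⇒AllPairs {[]}     []           _ = []
  Unique⇒AllPairs {x ∷ xs} (x∉xs ∷ !xs) S-distinct =
    All.tabulate (λ y∈xs → S-distinct (here refl) (there y∈xs) (All.lookup x∉xs y∈xs)) ∷
    Unique⇒AllPairs !xs (λ x∈xs y∈xs → S-distinct (there x∈xs) (there y∈xs))

  AllPairs-lookup : Symmetric S → ∀ {xs} → AllPairs S xs → ∀ {x y} → x ∈ xs → y ∈ xs → x ≢ y → S x y
  AllPairs-lookup sym (_ ∷ _)   (here refl) (here refl) x≢y = contradiction refl x≢y
  AllPairs-lookup sym (Sx ∷ _)  (here refl) (there y∈)  _   = All.lookup Sx y∈
  AllPairs-lookup sym (Sy ∷ _)  (there x∈)  (here refl) _   = sym (All.lookup Sy x∈)
  AllPairs-lookup sym (_ ∷ Sxs) (there x∈)  (there y∈)  x≢y = AllPairs-lookup sym Sxs x∈ y∈ x≢y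

length-cartesianProduct : ∀ {A B : Set} (xs : List A) (ys : List B) →
                          length (cartesianProduct xs ys) ≡ length xs * length ys
length-cartesianProduct []       ys = refl
length-cartesianProduct (x ∷ xs) ys = begin
  length (map (x ,_) ys ++ cartesianProduct xs ys)
    ≡⟨ length-++ (map (x ,_) ys) ⟩
  length (map (x ,_) ys) + length (cartesianProduct xs ys)
    ≡⟨ cong₂ _+_ (length-map (x ,_) ys) (length-cartesianProduct xs ys) ⟩
  length ys + length xs * length ys
    ∎
  where open ≡-Reasoning

module _ {m : ℕ} .{{_ : NonZero m}} where

  %-≡⇒balanced : ∀ x y → x % m ≡ y % m → x + y / m * m ≡ y + x / m * m
  %-≡⇒balanced x y eq = begin
    x + y / m * m                   ≡⟨ cong (_+ y / m * m) (m≡m%n+[m/n]*n x m) ⟩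
    x % m + x / m * m + y / m * m   ≡⟨ cong (λ r → r + x / m * m + y / m * m) eq ⟩
    y % m + x / m * m + y / m * m   ≡⟨ swap (y % m) (x / m * m) (y / m * m) ⟩
    y % m + y / m * m + x / m * m   ≡⟨ cong (_+ x / m * m) (m≡m%n+[m/n]*n y m) ⟨
    y + x / m * m                   ∎
    where
    open ≡-Reasoning
    swap : ∀ a b c → a + b + c ≡ a + c + b
    swap = solve-∀

  +-cancelˡ-% : ∀ x x′ y y′ → x % m ≡ x′ % m → (x + y) % m ≡ (x′ + y′) % m → y % m ≡ y′ % m
  +-cancelˡ-% x x′ y y′ eq-x eq-x+y = begin
    y % m            ≡⟨ [m+kn]%n≡m%n y P m ⟨
    (y + P * m) % m  ≡⟨ cong (_% m) balanced ⟩
    (y′ + Q * m) % m ≡⟨ [m+kn]%n≡m%n y′ Q m ⟩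
    y′ % m           ∎
    where
    open ≡-Reasoning
    P = (x′ + y′) / m + x / m
    Q = (x + y) / m + x′ / m
    regroup : ∀ x x′ y A B M → x + x′ + (y + (A + B) * M) ≡ (x + y + A * M) + (x′ + B * M)
    regroup = solve-∀
    balanced : y + P * m ≡ y′ + Q * m
    balanced = +-cancelˡ-≡ (x + x′) _ _ (begin
      x + x′ + (y + P * m)                              ≡⟨ regroup x x′ y ((x′ + y′) / m) (x / m) m ⟩
      (x + y + (x′ + y′) / m * m) + (x′ + x / m * m)
        ≡⟨ cong₂ _+_ (%-≡⇒balanced _ _ eq-x+y) (sym (%-≡⇒balanced _ _ eq-x)) ⟩
      (x′ + y′ + (x + y) / m * m) + (x + x′ / m * m)    ≡⟨ regroup x′ x y′ ((x + y) / m) (x′ / m) m ⟨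
      x′ + x + (y′ + Q * m)                             ≡⟨ cong (_+ (y′ + Q * m)) (+-comm x′ x) ⟩
      x + x′ + (y′ + Q * m)                             ∎)

  coprime-cancel-≤ : ∀ {s b b′} → Coprime m s → b′ ≤ b → b < m → (b * s) % m ≡ (b′ * s) % m → b ≡ b′
  coprime-cancel-≤ {s} {b} {b′} cop b′≤b b<m eq = begin
    b             ≡⟨ m∸n+n≡m b′≤b ⟨
    (b ∸ b′) + b′ ≡⟨ cong (_+ b′) δ≡0 ⟩
    b′            ∎
    where
    open ≡-Reasoning
    δ = b ∸ b′
    expand : ∀ b′ s δ → b′ * s + s * δ ≡ (δ + b′) * s
    expand = solve-∀
    sδ≡0 : (s * δ) % m ≡ 0 % m
    sδ≡0 = +-cancelˡ-% (b′ * s) (b′ * s) (s * δ) 0 refl (begin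
      (b′ * s + s * δ) % m ≡⟨ cong (_% m) (trans (expand b′ s δ) (cong (_* s) (m∸n+n≡m b′≤b))) ⟩
      (b * s) % m          ≡⟨ eq ⟩
      (b′ * s) % m         ≡⟨ cong (_% m) (+-identityʳ (b′ * s)) ⟨
      (b′ * s + 0) % m     ∎)
    m∣δ : m ∣ δ
    m∣δ = coprime-divisor cop (m%n≡0⇒n∣m (s * δ) m (trans sδ≡0 (m<n⇒m%n≡m (>-nonZero⁻¹ m))))
    δ≡0 : δ ≡ 0
    δ≡0 = trans (sym (m<n⇒m%n≡m (≤-<-trans (m∸n≤m b b′) b<m))) (n∣m⇒m%n≡0 δ m m∣δ)

  coprime-cancel : ∀ {s b b′} → Coprime m s → b < m → b′ < m → (b * s) % m ≡ (b′ * s) % m → b ≡ b′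
  coprime-cancel {b = b} {b′} cop b<m b′<m eq with ≤-total b′ b
  ... | inj₁ b′≤b = coprime-cancel-≤ cop b′≤b b<m eq
  ... | inj₂ b≤b′ = sym (coprime-cancel-≤ cop b≤b′ b′<m (sym eq))

  affine-agree-twice : ∀ {s a b a′ b′} i → Coprime m s → a < m → b < m → a′ < m → b′ < m →
                       (a + b * i) % m ≡ (a′ + b′ * i) % m →
                       (a + b * (i + s)) % m ≡ (a′ + b′ * (i + s)) % m →
                       a ≡ a′ × b ≡ b′
  affine-agree-twice {s} {a} {b} {a′} {b′} i cop a<m b<m a′<m b′<m agree-i agree-i+s = a≡a′ , b≡b′
    where
    open ≡-Reasoning
    shift : ∀ a b i s → a + b * (i + s) ≡ a + b * i + b * s
    shift = solve-∀
    b≡b′ : b ≡ b′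
    b≡b′ = coprime-cancel cop b<m b′<m (+-cancelˡ-% (a + b * i) (a′ + b′ * i) (b * s) (b′ * s) agree-i
             (subst₂ (λ x y → x % m ≡ y % m) (shift a b i s) (shift a′ b′ i s) agree-i+s))
    a≡a′ : a ≡ a′
    a≡a′ = begin
      a      ≡⟨ m<n⇒m%n≡m a<m ⟨
      a % m  ≡⟨ +-cancelˡ-% (b * i) (b′ * i) a a′ (cong (λ c → (c * i) % m) b≡b′)
                  (subst₂ (λ x y → x % m ≡ y % m) (+-comm a (b * i)) (+-comm a′ (b′ * i)) agree-i) ⟩
      a′ % m ≡⟨ m<n⇒m%n≡m a′<m ⟩
      a′     ∎

m≤n⇒m∣n! : ∀ {m n} → 0 < m → m ≤ n → m ∣ n !
m≤n⇒m∣n! {suc m} _ m≤n = ∣-trans (m∣m*n (m !)) (m≤n⇒m!∣n! m≤n)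

square-≤ : ∀ {a n} e → a ≤ n → n ≤ a + e → n * n ≤ a * a + 2 * e * n
square-≤ {a} {n} e a≤n n≤a+e = begin
  n * n                 ≤⟨ *-monoˡ-≤ n n≤a+e ⟩
  (a + e) * n           ≡⟨ *-distribʳ-+ n a e ⟩
  a * n + e * n         ≤⟨ +-monoˡ-≤ (e * n) (*-monoʳ-≤ a n≤a+e) ⟩
  a * (a + e) + e * n   ≡⟨ cong (_+ e * n) (*-distribˡ-+ a a e) ⟩
  a * a + a * e + e * n ≤⟨ +-monoˡ-≤ (e * n) (+-monoʳ-≤ (a * a) (*-monoˡ-≤ e a≤n)) ⟩
  a * a + n * e + e * n ≡⟨ collect a n e ⟩
  a * a + 2 * e * n     ∎
  where
  open ≤-Reasoning
  collect : ∀ a n e → a * a + n * e + e * n ≡ a * a + 2 * e * n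
  collect = solve-∀

n<b^n : ∀ {b} → 1 < b → ∀ n → n < b ^ n
n<b^n     1<b zero    = s≤s z≤n
n<b^n {b} 1<b (suc n) = begin-strict
  suc n          ≤⟨ n<b^n 1<b n ⟩
  b ^ n          <⟨ m<m+n (b ^ n) (≤-<-trans z≤n (n<b^n 1<b n)) ⟩
  b ^ n + b ^ n  ≡⟨ cong (b ^ n +_) (+-identityʳ (b ^ n)) ⟨
  2 * b ^ n      ≤⟨ *-monoˡ-≤ (b ^ n) 1<b ⟩
  b * b ^ n      ∎
  where open ≤-Reasoning

ratio-bound : ∀ {T X B n p q} → T * (n * n) ≤ T * X + n * n + B * n → q < T → q * B ≤ n → p < q →
              p * (n * n) ≤ q * X
ratio-bound {T} {X} {B} {n} {p} {q} bound q<T qB≤n p<q =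
  *-cancelˡ-≤ T {{>-nonZero (≤-<-trans z≤n q<T)}} (+-cancelʳ-≤ (suc q * (n * n)) _ _ (begin
    T * (p * (n * n)) + suc q * (n * n)   ≤⟨ +-monoʳ-≤ (T * (p * (n * n))) (*-monoˡ-≤ (n * n) q<T) ⟩
    T * (p * (n * n)) + T * (n * n)       ≡⟨ merge T p (n * n) ⟩
    T * suc p * (n * n)                   ≤⟨ *-monoˡ-≤ (n * n) (*-monoʳ-≤ T p<q) ⟩
    T * q * (n * n)                       ≡⟨ reassociate T q (n * n) ⟩
    q * (T * (n * n))                     ≤⟨ *-monoʳ-≤ q bound ⟩
    q * (T * X + n * n + B * n)           ≡⟨ distribute q T X (n * n) B n ⟩
    T * (q * X) + q * (n * n) + q * B * n ≤⟨ +-monoʳ-≤ (T * (q * X) + q * (n * n)) (*-monoˡ-≤ n qB≤n) ⟩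
    T * (q * X) + q * (n * n) + n * n     ≡⟨ collect T q X (n * n) ⟩
    T * (q * X) + suc q * (n * n)         ∎))
  where
  open ≤-Reasoning
  merge : ∀ T p x → T * (p * x) + T * x ≡ T * suc p * x
  merge = solve-∀
  reassociate : ∀ T q x → T * q * x ≡ q * (T * x)
  reassociate = solve-∀
  distribute : ∀ q T X x B n → q * (T * X + x + B * n) ≡ T * (q * X) + q * x + q * B * n
  distribute = solve-∀
  collect : ∀ T q X x → T * (q * X) + q * x + x ≡ T * (q * X) + suc q * x
  collect = solve-∀

bound-recurrence : ∀ k T B X {m n} e → T * (m * m) ≤ T * X + m * m + B * m →
                   suc k * m ≤ n → n ≤ suc k * m + e →
                   suc k * T * (n * n) ≤
                   suc k * T * (k * suc k * (m * m) + suc k * X) + n * n + (suc k * B + 2 * e * (suc k * T)) * n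
bound-recurrence k T B X {m} {n} e bound Km≤n n≤Km+e = begin
  K * T * (n * n)
    ≤⟨ *-monoʳ-≤ (K * T) (square-≤ e Km≤n n≤Km+e) ⟩
  K * T * (K * m * (K * m) + 2 * e * n)
    ≡⟨ expand k T m e n ⟩
  k * K * K * T * (m * m) + K * K * (T * (m * m)) + 2 * e * (K * T) * n
    ≤⟨ +-monoˡ-≤ (2 * e * (K * T) * n) (+-monoʳ-≤ (k * K * K * T * (m * m)) (*-monoʳ-≤ (K * K) bound)) ⟩
  k * K * K * T * (m * m) + K * K * (T * X + m * m + B * m) + 2 * e * (K * T) * n
    ≡⟨ distribute k T m e n X B ⟩
  k * K * K * T * (m * m) + K * K * T * X + K * m * (K * m) + K * B * (K * m) + 2 * e * (K * T) * n
    ≤⟨ +-monoˡ-≤ (2 * e * (K * T) * n) (+-mono-≤ (+-monoʳ-≤ (k * K * K * T * (m * m) + K * K * T * X)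
                                                              (*-mono-≤ Km≤n Km≤n))
                                                 (*-monoʳ-≤ (K * B) Km≤n)) ⟩
  k * K * K * T * (m * m) + K * K * T * X + n * n + K * B * n + 2 * e * (K * T) * n
    ≡⟨ collect k T m e n X B ⟩
  K * T * (k * K * (m * m) + K * X) + n * n + (K * B + 2 * e * (K * T)) * n
    ∎
  where
  open ≤-Reasoning
  K = suc k
  expand : ∀ k T m e n →
           suc k * T * (suc k * m * (suc k * m) + 2 * e * n) ≡
           k * suc k * suc k * T * (m * m) + suc k * suc k * (T * (m * m)) + 2 * e * (suc k * T) * n
  expand = solve-∀
  distribute : ∀ k T m e n X B →
               k * suc k * suc k * T * (m * m) + suc k * suc k * (T * X + m * m + B * m) + 2 * e * (suc k * T) * n ≡
               k * suc k * suc k * T * (m * m) + suc k * suc k * T * X + suc k * m * (suc k * m)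
                 + suc k * B * (suc k * m) + 2 * e * (suc k * T) * n
  distribute = solve-∀
  collect : ∀ k T m e n X B →
            k * suc k * suc k * T * (m * m) + suc k * suc k * T * X + n * n + suc k * B * n + 2 * e * (suc k * T) * n ≡
            suc k * T * (k * suc k * (m * m) + suc k * X) + n * n + (suc k * B + 2 * e * (suc k * T)) * n
  collect = solve-∀

module Construction (k : ℕ) where

  K : ℕ
  K = suc k

  TwoDistant : ∀ {n} → Rel (Word n) _
  TwoDistant u v = hd u v ≡ k + k ⊎ hd u v ≡ K + K

  TwoDistant-map : ∀ {a b} (f : Word a → Word b) → (∀ u v → hd (f u) (f v) ≡ hd u v) →
                   ∀ {u v} → TwoDistant u v → TwoDistant (f u) (f v)
  TwoDistant-map f hd-f {u} {v} = Sum.map (trans (hd-f u v)) (trans (hd-f u v))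

  TwoDistant-sym : ∀ {n} → Symmetric (TwoDistant {n})
  TwoDistant-sym {x = u} {v} = Sum.map (trans (hd-comm v u)) (trans (hd-comm v u))

  TwoDistant⇒≢ : ∀ {n} {u v : Word n} → 0 < k → TwoDistant u v → u ≢ v
  TwoDistant⇒≢ {u = u} 0<k dist refl = <⇒≢ (positive dist) (sym (hd-self u))
    where
    positive : TwoDistant u u → 0 < hd u u
    positive (inj₁ huu) = subst (0 <_) (sym huu) (<-≤-trans 0<k (m≤m+n k k))
    positive (inj₂ huu) = subst (0 <_) (sym huu) (s≤s z≤n)

  IsCWCode : ∀ n → List (Word n) → Set
  IsCWCode n C = AllPairs TwoDistant C × All (λ w → weight w ≡ K) C

  Attains : ∀ {n} → ℕ → List (Word n) → Set
  Attains {n} d C = ∃[ u ] ∃[ v ] (u ∈ C × v ∈ C × hd u v ≡ d)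

  AttainsBoth : ∀ {n} → List (Word n) → Set
  AttainsBoth C = Attains (k + k) C × Attains (K + K) C

  IsCWCode⇒IsTwoDistCode : ∀ {n C} → 0 < k → IsCWCode n C → AttainsBoth C → IsTwoDistCode n (k + k) (K + K) C
  IsCWCode⇒IsTwoDistCode 0<k (pairs , _) ((u , v , u∈ , v∈ , huv) , (u′ , v′ , u′∈ , v′∈ , hu′v′)) =
    AllPairs.map (TwoDistant⇒≢ 0<k) pairs ,
    (λ _ _ → AllPairs-lookup (λ {u} {v} → TwoDistant-sym {x = u} {v}) pairs) ,
    (u , v , u∈ , v∈ , TwoDistant⇒≢ 0<k (inj₁ huv) , huv) ,
    (u′ , v′ , u′∈ , v′∈ , TwoDistant⇒≢ 0<k (inj₂ hu′v′) , hu′v′)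

  module _ {a n} (a≤n : a ≤ n) where

    pad : Word a → Word n
    pad = padRight a≤n false

    IsCWCode-pad : ∀ {C} → IsCWCode a C → IsCWCode n (map pad C)
    IsCWCode-pad (pairs , weights) =
      AllPairs.map⁺ (AllPairs.map (TwoDistant-map pad (hd-padRight a≤n)) pairs) ,
      All.map⁺ (All.map (trans (weight-padRight a≤n _)) weights)

    Attains-pad : ∀ {d C} → Attains d C → Attains d (map pad C)
    Attains-pad (u , v , u∈ , v∈ , huv) =
      pad u , pad v , ∈-map⁺ pad u∈ , ∈-map⁺ pad v∈ , trans (hd-padRight a≤n u v) huv

  module Blocks (m : ℕ) where

    onlyAt : ℕ → Word m → ℕ → Word m
    onlyAt i w j with j ≟ i
    ... | yes _ = w
    ... | no  _ = zeros m

    onlyAt-here : ∀ i w → onlyAt i w i ≡ w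
    onlyAt-here i w with i ≟ i
    ... | yes _   = refl
    ... | no  i≢i = contradiction refl i≢i

    onlyAt-elsewhere : ∀ {i j} w → j ≢ i → onlyAt i w j ≡ zeros m
    onlyAt-elsewhere {i} {j} w j≢i with j ≟ i
    ... | yes j≡i = contradiction j≡i j≢i
    ... | no  _   = refl

    inBlock : ℕ → Word m → Word (K * m)
    inBlock i w = concatBlocks K (onlyAt i w)

    hd-inBlock-same : ∀ {i} u v → i < K → hd (inBlock i u) (inBlock i v) ≡ hd u v
    hd-inBlock-same {i} u v i<K = begin
      hd (inBlock i u) (inBlock i v)                      ≡⟨ hd-concatBlocks K (onlyAt i u) (onlyAt i v) ⟩
      sumBelow K (λ j → hd (onlyAt i u j) (onlyAt i v j)) ≡⟨ sumBelow-single K i<K (λ j _ → vanishes) ⟩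
      hd (onlyAt i u i) (onlyAt i v i)                    ≡⟨ cong₂ hd (onlyAt-here i u) (onlyAt-here i v) ⟩
      hd u v                                              ∎
      where
      open ≡-Reasoning
      vanishes : ∀ {j} → j ≢ i → hd (onlyAt i u j) (onlyAt i v j) ≡ 0
      vanishes j≢i = trans (cong₂ hd (onlyAt-elsewhere u j≢i) (onlyAt-elsewhere v j≢i)) (hd-self (zeros m))

    weight-inBlock : ∀ {i} u → i < K → weight (inBlock i u) ≡ weight u
    weight-inBlock {i} u i<K = begin
      weight (inBlock i u)                     ≡⟨ weight-concatBlocks K (onlyAt i u) ⟩
      sumBelow K (λ j → weight (onlyAt i u j)) ≡⟨ sumBelow-single K i<K (λ j _ → vanishes) ⟩
      weight (onlyAt i u i)                    ≡⟨ cong weight (onlyAt-here i u) ⟩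
      weight u                                 ∎
      where
      open ≡-Reasoning
      vanishes : ∀ {j} → j ≢ i → weight (onlyAt i u j) ≡ 0
      vanishes j≢i = trans (cong weight (onlyAt-elsewhere u j≢i)) (hd-self (zeros m))

    hd-inBlock-distinct : ∀ {i i′} u v → i < K → i′ < K → i ≢ i′ →
                          hd (inBlock i u) (inBlock i′ v) ≡ weight u + weight v
    hd-inBlock-distinct {i} {i′} u v i<K i′<K i≢i′ = begin
      hd (inBlock i u) (inBlock i′ v)
        ≡⟨ hd-concatBlocks K (onlyAt i u) (onlyAt i′ v) ⟩
      sumBelow K (λ j → hd (onlyAt i u j) (onlyAt i′ v j))
        ≡⟨ sumBelow-cong K (λ j _ → hd-zeros-either (disjoint j)) ⟩
      sumBelow K (λ j → weight (onlyAt i u j) + weight (onlyAt i′ v j))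
        ≡⟨ sumBelow-+ K (λ j → weight (onlyAt i u j)) (λ j → weight (onlyAt i′ v j)) ⟩
      sumBelow K (λ j → weight (onlyAt i u j)) + sumBelow K (λ j → weight (onlyAt i′ v j))
        ≡⟨ cong₂ _+_ (weight-concatBlocks K (onlyAt i u)) (weight-concatBlocks K (onlyAt i′ v)) ⟨
      weight (inBlock i u) + weight (inBlock i′ v)
        ≡⟨ cong₂ _+_ (weight-inBlock u i<K) (weight-inBlock v i′<K) ⟩
      weight u + weight v
        ∎
      where
      open ≡-Reasoning
      disjoint : ∀ j → onlyAt i u j ≡ zeros m ⊎ onlyAt i′ v j ≡ zeros m
      disjoint j = case j ≟ i of λ where
        (yes refl) → inj₂ (onlyAt-elsewhere v i≢i′)
        (no j≢i)   → inj₁ (onlyAt-elsewhere u j≢i)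

    hd-inBlock-concatBlocks : ∀ {i c} u (g : ℕ → Word m) → i < K → (∀ j → j < K → weight (g j) ≡ c) →
                              hd (inBlock i u) (concatBlocks K g) + c ≡ K * c + hd u (g i)
    hd-inBlock-concatBlocks {i} {c} u g i<K weight-g = begin
      hd (inBlock i u) (concatBlocks K g) + c        ≡⟨ cong (_+ c) (hd-concatBlocks K (onlyAt i u) g) ⟩
      sumBelow K (λ j → hd (onlyAt i u j) (g j)) + c ≡⟨ sumBelow-constExcept K c i<K elsewhere ⟩
      K * c + hd (onlyAt i u i) (g i)                ≡⟨ cong (λ w → K * c + hd w (g i)) (onlyAt-here i u) ⟩
      K * c + hd u (g i)                             ∎
      where
      open ≡-Reasoning
      elsewhere : ∀ j → j < K → j ≢ i → hd (onlyAt i u j) (g j) ≡ c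
      elsewhere j j<K j≢i = begin
        hd (onlyAt i u j) (g j) ≡⟨ cong (λ w → hd w (g j)) (onlyAt-elsewhere u j≢i) ⟩
        hd (zeros m) (g j)      ≡⟨ hd-comm (zeros m) (g j) ⟩
        weight (g j)            ≡⟨ weight-g j j<K ⟩
        c                       ∎

    blockCopies : ℕ → List (Word m) → List (Word (K * m))
    blockCopies zero    C = []
    blockCopies (suc c) C = map (inBlock c) C ++ blockCopies c C

    length-blockCopies : ∀ c C → length (blockCopies c C) ≡ c * length C
    length-blockCopies zero    C = refl
    length-blockCopies (suc c) C =
      trans (length-++ (map (inBlock c) C)) (cong₂ _+_ (length-map (inBlock c) C) (length-blockCopies c C))

    ∈-blockCopies⁻ : ∀ c {C y} → y ∈ blockCopies c C → ∃[ i ] ∃[ w ] (i < c × w ∈ C × y ≡ inBlock i w)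
    ∈-blockCopies⁻ (suc c) {C} y∈ with ∈-++⁻ (map (inBlock c) C) y∈
    ... | inj₁ y∈map with ∈-map⁻ (inBlock c) y∈map
    ...   | w , w∈ , refl = c , w , ≤-refl , w∈ , refl
    ∈-blockCopies⁻ (suc c) y∈ | inj₂ y∈rest with ∈-blockCopies⁻ c y∈rest
    ...   | i , w , i<c , w∈ , refl = i , w , m<n⇒m<1+n i<c , w∈ , refl

    IsCWCode-blockCopies : ∀ c {C} → c ≤ K → IsCWCode m C → IsCWCode (K * m) (blockCopies c C)
    IsCWCode-blockCopies zero    _   _ = [] , []
    IsCWCode-blockCopies (suc c) {C} c<K code@(pairs , weights) =
      AllPairs.++⁺ (AllPairs.map⁺ (AllPairs.map (TwoDistant-map (inBlock c) (λ u v → hd-inBlock-same u v c<K)) pairs))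
                   (proj₁ rest)
                   (All.map⁺ (All.tabulate (λ u∈ → All.tabulate (λ y∈ → inj₂ (across u∈ y∈))))) ,
      All.++⁺ (All.map⁺ (All.map (trans (weight-inBlock _ c<K)) weights)) (proj₂ rest)
      where
      rest = IsCWCode-blockCopies c (≤-trans (n≤1+n c) c<K) code
      across : ∀ {u y} → u ∈ C → y ∈ blockCopies c C → hd (inBlock c u) y ≡ K + K
      across u∈ y∈ with ∈-blockCopies⁻ c y∈
      ... | i , w , i<c , w∈ , refl =
        trans (hd-inBlock-distinct _ w c<K (<-trans i<c c<K) (≢-sym (<⇒≢ i<c)))
              (cong₂ _+_ (All.lookup weights u∈) (All.lookup weights w∈))

  module Lines (m : ℕ) .{{_ : NonZero m}} (coprime : ∀ {s} → 0 < s → s ≤ k → Coprime m s) where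
    open Blocks m

    point : ℕ × ℕ → ℕ → ℕ
    point (a , b) j = (a + b * j) % m

    column : ℕ × ℕ → ℕ → Word m
    column p j = unit m (point p j)

    line : ℕ × ℕ → Word (K * m)
    line p = concatBlocks K (column p)

    InRange : ℕ × ℕ → Set
    InRange (a , b) = a < m × b < m

    Meet : ℕ × ℕ → ℕ × ℕ → ℕ → Set
    Meet p p′ j = point p j ≡ point p′ j

    point<m : ∀ p j → point p j < m
    point<m (a , b) j = m%n<n (a + b * j) m

    weight-line : ∀ p → weight (line p) ≡ K
    weight-line p = begin
      weight (line p)                        ≡⟨ weight-concatBlocks K (column p) ⟩
      sumBelow K (λ j → weight (column p j)) ≡⟨ sumBelow-const K 1 (λ j _ → weight-unit (point<m p j)) ⟩
      K * 1                                  ≡⟨ *-identityʳ K ⟩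
      K                                      ∎
      where open ≡-Reasoning

    meet-at-most-once-< : ∀ {p p′ i j} → InRange p → InRange p′ → i < j → j < K →
                          Meet p p′ i → Meet p p′ j → p ≡ p′
    meet-at-most-once-< {a , b} {a′ , b′} {i} {j} (a<m , b<m) (a′<m , b′<m) i<j j<K meet-i meet-j
      with affine-agree-twice i (coprime (m<n⇒0<n∸m i<j) (≤-trans (m∸n≤m j i) (≤-pred j<K)))
             a<m b<m a′<m b′<m meet-i (subst (Meet (a , b) (a′ , b′)) (sym (m+[n∸m]≡n (<⇒≤ i<j))) meet-j)
    ... | refl , refl = refl

    meet-at-most-once : ∀ {p p′ i j} → InRange p → InRange p′ → i ≢ j → i < K → j < K →
                        Meet p p′ i → Meet p p′ j → p ≡ p′
    meet-at-most-once {i = i} {j} r r′ i≢j i<K j<K meet-i meet-j with <-cmp i j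
    ... | tri< i<j _ _ = meet-at-most-once-< r r′ i<j j<K meet-i meet-j
    ... | tri≈ _ i≡j _ = contradiction i≡j i≢j
    ... | tri> _ _ j<i = meet-at-most-once-< r r′ j<i i<K meet-j meet-i

    hd-line-meeting : ∀ {p p′ j₀} → InRange p → InRange p′ → p ≢ p′ → j₀ < K → Meet p p′ j₀ →
                      hd (line p) (line p′) ≡ k + k
    hd-line-meeting {p} {p′} {j₀} r r′ p≢p′ j₀<K meet = +-cancelʳ-≡ 2 _ _ (begin
      hd (line p) (line p′) + 2                             ≡⟨ cong (_+ 2) (hd-concatBlocks K (column p) (column p′)) ⟩
      sumBelow K (λ j → hd (column p j) (column p′ j)) + 2  ≡⟨ sumBelow-constExcept K 2 j₀<K elsewhere ⟩
      K * 2 + hd (column p j₀) (column p′ j₀)               ≡⟨ cong (λ x → K * 2 + hd (unit m x) (column p′ j₀)) meet ⟩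
      K * 2 + hd (column p′ j₀) (column p′ j₀)              ≡⟨ cong (K * 2 +_) (hd-self (column p′ j₀)) ⟩
      K * 2 + 0                                             ≡⟨ double k ⟩
      k + k + 2                                             ∎)
      where
      open ≡-Reasoning
      elsewhere : ∀ j → j < K → j ≢ j₀ → hd (column p j) (column p′ j) ≡ 2
      elsewhere j j<K j≢j₀ = hd-unit-unit (point<m p j) (point<m p′ j)
                               (λ meet-j → p≢p′ (meet-at-most-once r r′ j≢j₀ j<K j₀<K meet-j meet))
      double : ∀ k → suc k * 2 + 0 ≡ k + k + 2
      double = solve-∀

    hd-line-disjoint : ∀ p p′ → (∀ j → j < K → ¬ Meet p p′ j) → hd (line p) (line p′) ≡ K + K
    hd-line-disjoint p p′ apart = begin
      hd (line p) (line p′)                             ≡⟨ hd-concatBlocks K (column p) (column p′) ⟩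
      sumBelow K (λ j → hd (column p j) (column p′ j))  ≡⟨ sumBelow-const K 2 differ ⟩
      K * 2                                             ≡⟨ *-comm K 2 ⟩
      K + (K + 0)                                       ≡⟨ cong (K +_) (+-identityʳ K) ⟩
      K + K                                             ∎
      where
      open ≡-Reasoning
      differ : ∀ j → j < K → hd (column p j) (column p′ j) ≡ 2
      differ j j<K = hd-unit-unit (point<m p j) (point<m p′ j) (apart j j<K)

    TwoDistant-lines : ∀ {p p′} → InRange p → InRange p′ → p ≢ p′ → TwoDistant (line p) (line p′)
    TwoDistant-lines {p} {p′} r r′ p≢p′ with anyUpTo? (λ j → point p j ≟ point p′ j) K
    ... | yes (j₀ , j₀<K , meet) = inj₁ (hd-line-meeting r r′ p≢p′ j₀<K meet)
    ... | no  never              = inj₂ (hd-line-disjoint p p′ (λ j j<K meet → never (j , j<K , meet)))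

    TwoDistant-inBlock-line : ∀ {i u} p → i < K → weight u ≡ K → TwoDistant (inBlock i u) (line p)
    TwoDistant-inBlock-line {i} {u} p i<K weight-u = classify (hd-unit u (point<m p i))
      where
      open ≡-Reasoning
      blockwise : hd (inBlock i u) (line p) + 1 ≡ K * 1 + hd u (column p i)
      blockwise = hd-inBlock-concatBlocks u (column p) i<K (λ j _ → weight-unit (point<m p j))
      below : ∀ k → suc k * 1 + k ≡ k + k + 1
      below = solve-∀
      above : ∀ k → suc k * 1 + suc (suc k) ≡ suc k + suc k + 1
      above = solve-∀
      classify : suc (hd u (column p i)) ≡ weight u ⊎ hd u (column p i) ≡ suc (weight u) →
                 TwoDistant (inBlock i u) (line p)
      classify (inj₁ one-less) = inj₁ (+-cancelʳ-≡ 1 _ _ (begin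
        hd (inBlock i u) (line p) + 1 ≡⟨ blockwise ⟩
        K * 1 + hd u (column p i)     ≡⟨ cong (K * 1 +_) (suc-injective (trans one-less weight-u)) ⟩
        K * 1 + k                     ≡⟨ below k ⟩
        k + k + 1                     ∎))
      classify (inj₂ one-more) = inj₂ (+-cancelʳ-≡ 1 _ _ (begin
        hd (inBlock i u) (line p) + 1 ≡⟨ blockwise ⟩
        K * 1 + hd u (column p i)     ≡⟨ cong (K * 1 +_) (trans one-more (cong suc weight-u)) ⟩
        K * 1 + suc K                 ≡⟨ above k ⟩
        K + K + 1                     ∎))

    points : List (ℕ × ℕ)
    points = cartesianProduct (upTo m) (upTo m)

    ∈-points⁻ : ∀ {p} → p ∈ points → InRange p
    ∈-points⁻ p∈ with ∈-cartesianProduct⁻ (upTo m) (upTo m) p∈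
    ... | a∈ , b∈ = ∈-upTo⁻ a∈ , ∈-upTo⁻ b∈

    ∈-points⁺ : ∀ {p} → InRange p → p ∈ points
    ∈-points⁺ (a<m , b<m) = ∈-cartesianProduct⁺ (∈-upTo⁺ a<m) (∈-upTo⁺ b<m)

    extend : List (Word m) → List (Word (K * m))
    extend C = map line points ++ blockCopies K C

    length-extend : ∀ C → length (extend C) ≡ m * m + K * length C
    length-extend C = begin
      length (map line points ++ blockCopies K C)
        ≡⟨ length-++ (map line points) ⟩
      length (map line points) + length (blockCopies K C)
        ≡⟨ cong₂ _+_ (length-map line points) (length-blockCopies K C) ⟩
      length points + K * length C
        ≡⟨ cong (_+ K * length C) (length-cartesianProduct (upTo m) (upTo m)) ⟩
      length (upTo m) * length (upTo m) + K * length C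
        ≡⟨ cong (λ x → x * x + K * length C) (length-upTo m) ⟩
      m * m + K * length C
        ∎
      where open ≡-Reasoning

    IsCWCode-extend : ∀ {C} → IsCWCode m C → IsCWCode (K * m) (extend C)
    IsCWCode-extend {C} code@(_ , weights) =
      AllPairs.++⁺ line-pairs (proj₁ copies)
        (All.map⁺ {f = line} (All.tabulate {xs = points} (λ {p} _ → All.tabulate (line-copy {p})))) ,
      All.++⁺ (All.map⁺ {f = line} (All.tabulate {xs = points} (λ {p} _ → weight-line p))) (proj₂ copies)
      where
      copies = IsCWCode-blockCopies K ≤-refl code
      line-pairs : AllPairs TwoDistant (map line points)
      line-pairs = AllPairs.map⁺ {f = line}
        (Unique⇒AllPairs (Unique.cartesianProduct⁺ (Unique.upTo⁺ m) (Unique.upTo⁺ m))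
                         (λ p∈ p′∈ → TwoDistant-lines (∈-points⁻ p∈) (∈-points⁻ p′∈)))
      line-copy : ∀ {p y} → y ∈ blockCopies K C → TwoDistant (line p) y
      line-copy {p} y∈ with ∈-blockCopies⁻ K y∈
      ... | i , w , i<K , w∈ , refl =
        TwoDistant-sym {x = inBlock i w} (TwoDistant-inBlock-line p i<K (All.lookup weights w∈))

    AttainsBoth-extend : ∀ C → 1 < m → AttainsBoth (extend C)
    AttainsBoth-extend C 1<m =
      (line origin , line (0 , 1) , member (0<m , 0<m) , member (0<m , 1<m) ,
       hd-line-meeting (0<m , 0<m) (0<m , 1<m) (λ ()) (s≤s z≤n) refl) ,
      (line origin , line (1 , 0) , member (0<m , 0<m) , member (1<m , 0<m) ,
       hd-line-disjoint origin (1 , 0) (λ j _ → parallel j))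
      where
      origin = (0 , 0)
      0<m : 0 < m
      0<m = <-trans (s≤s z≤n) 1<m
      member : ∀ {p} → InRange p → line p ∈ extend C
      member r = ∈-++⁺ˡ (∈-map⁺ line (∈-points⁺ r))
      parallel : ∀ j → ¬ Meet origin (1 , 0) j
      parallel j meet = 0≢1+n (begin
        0               ≡⟨ m<n⇒m%n≡m 0<m ⟨
        0 % m           ≡⟨ meet ⟩
        (1 + 0 * j) % m ≡⟨ m<n⇒m%n≡m 1<m ⟩
        1               ∎)
        where open ≡-Reasoning

  E : ℕ
  E = K * suc (k !)

  record Split (n : ℕ) : Set where
    field
      m       : ℕ
      1<m     : 1 < m
      lower   : K * m ≤ n
      upper   : n ≤ K * m + E
      coprime : ∀ {s} → 0 < s → s ≤ k → Coprime m s

  1+j*k!-coprime : ∀ j {s} → 0 < s → s ≤ k → Coprime (suc (j * k !)) s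
  1+j*k!-coprime j 0<s s≤k {d} (d∣m , d∣s) =
    ∣1⇒≡1 (∣m+n∣m⇒∣n (subst (d ∣_) (+-comm 1 (j * k !)) d∣m) d∣j*k!)
    where
    d∣j*k! : d ∣ j * k !
    d∣j*k! = ∣-trans d∣s (∣-trans (m≤n⇒m∣n! 0<s s≤k) (n∣m*n j))

  split : ∀ {n} → E ≤ n → Split n
  split {n} E≤n = record
    { m       = suc (j * k !)
    ; 1<m     = s≤s (*-mono-≤ (m≥n⇒m/n>0 N≤n∸K) (1≤n! k))
    ; lower   = begin
        K * suc (j * k !) ≡⟨ K*m ⟩
        K + j * N         ≤⟨ +-monoʳ-≤ K (m/n*n≤m (n ∸ K) N) ⟩
        K + (n ∸ K)       ≡⟨ m+[n∸m]≡n K≤n ⟩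
        n                 ∎
    ; upper   = begin
        n                                ≡⟨ m+[n∸m]≡n K≤n ⟨
        K + (n ∸ K)                      ≡⟨ cong (K +_) (m≡m%n+[m/n]*n (n ∸ K) N) ⟩
        K + ((n ∸ K) % N + j * N)        ≤⟨ +-monoʳ-≤ K (+-monoˡ-≤ (j * N) (<⇒≤ (m%n<n (n ∸ K) N))) ⟩
        K + (N + j * N)                  ≡⟨ rearrange K N (j * N) ⟩
        K + j * N + N                    ≡⟨ cong (_+ N) K*m ⟨
        K * suc (j * k !) + N            ≤⟨ +-monoʳ-≤ (K * suc (j * k !)) (*-monoʳ-≤ K (n≤1+n (k !))) ⟩
        K * suc (j * k !) + E            ∎
    ; coprime = 1+j*k!-coprime j
    }
    where
    open ≤-Reasoning
    N : ℕ
    N = K * k !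
    instance
      N≢0 : NonZero N
      N≢0 = m*n≢0 K (k !) {{_}} {{k !≢0}}
    j : ℕ
    j = (n ∸ K) / N
    K*m : K * suc (j * k !) ≡ K + j * N
    K*m = distribute K j (k !)
      where
      distribute : ∀ K j L → K * suc (j * L) ≡ K + j * (K * L)
      distribute = solve-∀
    rearrange : ∀ a b c → a + (b + c) ≡ a + c + b
    rearrange = solve-∀
    K≤n : K ≤ n
    K≤n = ≤-trans (m≤m*n K (suc (k !))) E≤n
    N≤n∸K : N ≤ n ∸ K
    N≤n∸K = begin
      K * k !          ≡⟨ m+n∸m≡n K (K * k !) ⟨
      K + K * k ! ∸ K  ≡⟨ cong (_∸ K) (*-suc K (k !)) ⟨
      E ∸ K            ≤⟨ ∸-monoˡ-≤ K E≤n ⟩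
      n ∸ K            ∎

  -- Divided by T: kK·|C| ≥ (1 − 1/T)·n² − (B/T)·n.  After t rounds of the recursion T = K ^ t.
  record Bound (T B : ℕ) {n} (C : List (Word n)) : Set where
    constructor bounded
    field
      holds : T * (n * n) ≤ T * (k * K * length C) + n * n + B * n

  BoundedCode : (T B n : ℕ) → Set
  BoundedCode T B n = Σ[ C ∈ List (Word n) ] (IsCWCode n C × Bound T B C)

  nextSlack : ℕ → ℕ → ℕ
  nextSlack T B = K * B + 2 * E * (K * T)

  Bound-step : ∀ {T B m n} {C : List (Word m)} {C′ : List (Word n)} → Bound T B C →
               length C′ ≡ m * m + K * length C → K * m ≤ n → n ≤ K * m + E →
               Bound (K * T) (nextSlack T B) C′
  Bound-step {T} {B} {m} {n} {C} {C′} (bounded bound) length-C′ Km≤n n≤Km+E = bounded (begin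
    K * T * (n * n)
      ≤⟨ bound-recurrence k T B (k * K * length C) E bound Km≤n n≤Km+E ⟩
    K * T * (k * K * (m * m) + K * (k * K * length C)) + n * n + nextSlack T B * n
      ≡⟨ cong (λ x → K * T * x + n * n + nextSlack T B * n) (distribute k m (length C)) ⟩
    K * T * (k * K * (m * m + K * length C)) + n * n + nextSlack T B * n
      ≡⟨ cong (λ x → K * T * (k * K * x) + n * n + nextSlack T B * n) length-C′ ⟨
    K * T * (k * K * length C′) + n * n + nextSlack T B * n
      ∎)
    where
    open ≤-Reasoning
    distribute : ∀ k m c → k * suc k * (m * m) + suc k * (k * suc k * c) ≡ k * suc k * (m * m + suc k * c)
    distribute = solve-∀

  Bound-[] : ∀ {T B} → Bound T B {0} []
  Bound-[] {T} {B} = bounded (subst (_≤ T * (k * K * 0) + 0 + B * 0) (sym (*-zeroʳ T)) z≤n)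

  nextCode : ∀ {T B} → (∀ m → BoundedCode T B m) → ∀ n →
         Σ[ C ∈ List (Word n) ] (IsCWCode n C × Bound (K * T) (nextSlack T B) C × (E ≤ n → AttainsBoth C))
  nextCode {B = B} codes n with E ≤? n
  -- Below E the empty code will do: its bound is the m = 0 instance of Bound-step.
  ... | no E≰n =
    [] , ([] , []) , Bound-step (Bound-[] {B = B}) (sym (*-zeroʳ K)) K*0≤n n≤K*0+E , λ E≤n → contradiction E≤n E≰n
    where
    K*0≤n : K * 0 ≤ n
    K*0≤n = subst (_≤ n) (sym (*-zeroʳ K)) z≤n
    n≤K*0+E : n ≤ K * 0 + E
    n≤K*0+E = ≤-trans (<⇒≤ (≰⇒> E≰n)) (m≤n+m E (K * 0))
  ... | yes E≤n = map (pad lower) (extend C) ,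
                  IsCWCode-pad lower (IsCWCode-extend code) ,
                  Bound-step bound (trans (length-map (pad lower) (extend C)) (length-extend C)) lower upper ,
                  λ _ → Attains-pad lower (proj₁ both) , Attains-pad lower (proj₂ both)
    where
    open Split (split E≤n)
    open Lines m {{>-nonZero (<-trans (s≤s z≤n) 1<m)}} coprime
    C = proj₁ (codes m)
    code = proj₁ (proj₂ (codes m))
    bound = proj₂ (proj₂ (codes m))
    both = AttainsBoth-extend C 1<m

  slack : ℕ → ℕ
  slack zero    = 0
  slack (suc t) = nextSlack (K ^ t) (slack t)

  boundedCode : ∀ t n → BoundedCode (K ^ t) (slack t) n
  boundedCode zero    n = [] , ([] , []) , bounded (+-monoˡ-≤ 0 (m≤n+m (n * n) (k * K * 0 + 0)))
  boundedCode (suc t) n with nextCode (boundedCode t) n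
  ... | C , code , bound , _ = C , code , bound

  optimal-lower-bound : 0 < k → ∀ {p q} → p < q →
                        ∃[ n₀ ] ∀ n → n₀ < n → ∀ C → IsOptimal n (k + k) (K + K) C →
                        p * (n * n) ≤ q * (k * K * length C)
  optimal-lower-bound 0<k {p} {q} p<q = q * slack (suc q) + E , large
    where
    large : ∀ n → q * slack (suc q) + E < n → ∀ C → IsOptimal n (k + k) (K + K) C →
            p * (n * n) ≤ q * (k * K * length C)
    large n n₀<n C (_ , maximal) with nextCode (boundedCode q) n
    ... | C′ , code , bounded bound , attains = begin
      p * (n * n)             ≤⟨ ratio-bound bound q<K^[1+q] q*slack≤n p<q ⟩
      q * (k * K * length C′) ≤⟨ *-monoʳ-≤ q (*-monoʳ-≤ (k * K) (maximal C′ two-distance)) ⟩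
      q * (k * K * length C)  ∎
      where
      open ≤-Reasoning
      q<K^[1+q] : q < K ^ suc q
      q<K^[1+q] = <-trans (n<1+n q) (n<b^n (s≤s 0<k) (suc q))
      q*slack≤n : q * slack (suc q) ≤ n
      q*slack≤n = ≤-trans (m≤m+n _ E) (<⇒≤ n₀<n)
      two-distance = IsCWCode⇒IsTwoDistCode 0<k code (attains (≤-trans (m≤n+m E _) (<⇒≤ n₀<n)))

corollary2 : ∀ (d : ℕ) → 4 ≤ d → 2 ∣ d →
    ∀ (p q : ℕ) → 0 < p → p < q →
    ∃[ n₀ ] ∀ (n : ℕ) → n₀ < n → ∀ C → IsOptimal n d (d + 2) C →
      p * n ^ 2 ≤ q * ((d / 2 + 1) * (d / 2) * length C)
corollary2 _ () (divides zero refl) p q _ p<q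
corollary2 _ _  (divides k@(suc _) refl) p q _ p<q =
  let n₀ , bound = Construction.optimal-lower-bound k (s≤s z≤n) p<q in
  n₀ , λ n n₀<n C optimal → begin
    p * n ^ 2                                      ≡⟨ cong (λ x → p * (n * x)) (*-identityʳ n) ⟩
    p * (n * n)                                    ≤⟨ bound n n₀<n C (subst₂ (λ d₁ d₂ → IsOptimal n d₁ d₂ C)
                                                                              (double k) (double+2 k) optimal) ⟩
    q * (k * suc k * length C)                     ≡⟨ reorder q k (length C) ⟩
    q * ((k + 1) * k * length C)                   ≡⟨ cong (λ h → q * ((h + 1) * h * length C)) (m*n/n≡m k 2) ⟨
    q * ((k * 2 / 2 + 1) * (k * 2 / 2) * length C) ∎
  where
  open ≤-Reasoning
  double : ∀ k → k * 2 ≡ k + k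
  double = solve-∀
  double+2 : ∀ k → k * 2 + 2 ≡ suc k + suc k
  double+2 = solve-∀
  reorder : ∀ q k c → q * (k * suc k * c) ≡ q * ((k + 1) * k * c)
  reorder = solve-∀
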